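{- For all positive integers $t$ and $n$, the independent domination polynomial $D_i(K_{t,n}\circ K_1,x)$ is log-concave, and therefore unimodal.
   Context: All graphs are finite and simple. A set $S\subseteq V(G)$ is an independent dominating set of $G$ if no two vertices of $S$ are adjacent and every vertex of $V(G)\setminus S$ has a neighbour in $S$; $d_i(G,k)$ is the number of such sets of size $k$ and $D_i(G,x)=\sum_k d_i(G,k)x^k$. $K_{t,n}$ is the complete bipartite graph. For graphs $G,H$, the corona $G\circ H$ is obtained from $G$ by taking, for each vertex $v$ of $G$, a new disjoint copy of $H$ and joining $v$ to every vertex of that copy. A polynomial $\sum_{k=0}^n a_kx^k$ with nonnegative coefficients is log-concave if $a_k^2\ge a_{k-1}a_{k+1}$ for $1\le k\le n-1$, and unimodal if for some $m$, $a_0\le\dots\le a_m\ge a_{m+1}\ge\dots\ge a_n$. -}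

module Defs where

open import Data.Nat using (ℕ; zero; suc; _+_; _*_; _∸_; _≤_; _<_)
import Data.Nat as ℕ
open import Data.Bool using (Bool; true; false; _∧_; _∨_; not)
open import Data.List using (List; []; _∷_; map; length; filterᵇ; allFin; concatMap)
open import Data.Vec using (Vec; []; _∷_; lookup)
open import Data.Fin using (Fin; splitAt; remQuot)
import Data.Fin as F
open import Data.Sum using (_⊎_; inj₁; inj₂)
open import Data.Product using (_×_; _,_; proj₁; proj₂; Σ; ∃-syntax)
open import Relation.Binary.PropositionalEquality using (_≡_; refl; sym)
open import Relation.Nullary.Decidable using (⌊_⌋; yes; no)
open import Relation.Binary.PropositionalEquality using (cong₂)
open import Data.Empty using (⊥-elim)
open import Data.Bool.Properties using (∧-zeroʳ)

record Graph : Set where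
  field
    n       : ℕ
    adj     : Fin n → Fin n → Bool
    adj-sym : ∀ u v → adj u v ≡ adj v u
    adj-irr : ∀ v → adj v v ≡ false
open Graph public

allSubsets : (m : ℕ) → List (Vec Bool m)
allSubsets zero    = [] ∷ []
allSubsets (suc m) = concatMap (λ s → (true ∷ s) ∷ (false ∷ s) ∷ []) (allSubsets m)

count : {m : ℕ} → Vec Bool m → ℕ
count []          = 0
count (true ∷ s)  = suc (count s)
count (false ∷ s) = count s

allB : {A : Set} → (A → Bool) → List A → Bool
allB p []       = true
allB p (x ∷ xs) = p x ∧ allB p xs

anyB : {A : Set} → (A → Bool) → List A → Bool
anyB p []       = false
anyB p (x ∷ xs) = p x ∨ anyB p xs

independentB : (G : Graph) → Vec Bool (n G) → Bool
independentB G S =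
  allB (λ u → allB (λ w → not (lookup S u ∧ lookup S w ∧ adj G u w)) (allFin (n G))) (allFin (n G))

dominatingB : (G : Graph) → Vec Bool (n G) → Bool
dominatingB G S =
  allB (λ v → lookup S v ∨ anyB (λ u → lookup S u ∧ adj G v u) (allFin (n G))) (allFin (n G))

IsIndependentDominating : (G : Graph) → Vec Bool (n G) → Set
IsIndependentDominating G S = (independentB G S ∧ dominatingB G S) ≡ true

d-i : Graph → ℕ → ℕ
d-i G k = length (filterᵇ (λ S → ⌊ count S ℕ.≟ k ⌋ ∧ independentB G S ∧ dominatingB G S)
                           (allSubsets (n G)))

sameSide : {a b : ℕ} → Fin a ⊎ Fin b → Fin a ⊎ Fin b → Bool
sameSide (inj₁ _) (inj₁ _) = true
sameSide (inj₂ _) (inj₂ _) = true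
sameSide _        _        = false

sameSide-sym : {a b : ℕ} (x y : Fin a ⊎ Fin b) → sameSide x y ≡ sameSide y x
sameSide-sym (inj₁ _) (inj₁ _) = refl
sameSide-sym (inj₁ _) (inj₂ _) = refl
sameSide-sym (inj₂ _) (inj₁ _) = refl
sameSide-sym (inj₂ _) (inj₂ _) = refl

sameSide-refl : {a b : ℕ} (x : Fin a ⊎ Fin b) → sameSide x x ≡ true
sameSide-refl (inj₁ _) = refl
sameSide-refl (inj₂ _) = refl

Kbip : ℕ → ℕ → Graph
Kbip t m = record
  { n       = t + m
  ; adj     = λ u v → not (sameSide (splitAt t u) (splitAt t v))
  ; adj-sym = λ u v → Relation.Binary.PropositionalEquality.cong not
                        (sameSide-sym (splitAt t u) (splitAt t v))
  ; adj-irr = λ v → Relation.Binary.PropositionalEquality.cong not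
                        (sameSide-refl (splitAt t v))
  }

K1 : Graph
K1 = record { n = 1 ; adj = λ _ _ → false ; adj-sym = λ _ _ → refl ; adj-irr = λ _ → refl }

-- Vertex set Fin (N + N * M) where N = |G|, M = |H|:
-- splitAt N gives inj₁ v (a vertex v of G) or inj₂ j, and
-- remQuot M j = (v , a) means "vertex a of the copy of H attached to v".

coronaAdj : (G H : Graph) → (Fin (n G) ⊎ (Fin (n G) × Fin (n H)))
          → (Fin (n G) ⊎ (Fin (n G) × Fin (n H))) → Bool
coronaAdj G H (inj₁ u)       (inj₁ v)       = adj G u v
coronaAdj G H (inj₁ u)       (inj₂ (v , b)) = ⌊ u F.≟ v ⌋
coronaAdj G H (inj₂ (u , a)) (inj₁ v)       = ⌊ u F.≟ v ⌋
coronaAdj G H (inj₂ (u , a)) (inj₂ (v , b)) = ⌊ u F.≟ v ⌋ ∧ adj H a b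

decode : (G H : Graph) → Fin (n G + n G * n H) → Fin (n G) ⊎ (Fin (n G) × Fin (n H))
decode G H i with splitAt (n G) i
... | inj₁ v = inj₁ v
... | inj₂ j = inj₂ (remQuot (n H) j)

≟-sym : {N : ℕ} (u v : Fin N) → ⌊ u F.≟ v ⌋ ≡ ⌊ v F.≟ u ⌋
≟-sym u v with u F.≟ v | v F.≟ u
... | yes _   | yes _   = refl
... | no _    | no _    = refl
... | yes u≡v | no v≢u  = ⊥-elim (v≢u (sym u≡v))
... | no u≢v  | yes v≡u = ⊥-elim (u≢v (sym v≡u))

coronaAdj-sym : (G H : Graph) → ∀ x y → coronaAdj G H x y ≡ coronaAdj G H y x
coronaAdj-sym G H (inj₁ u)       (inj₁ v)       = adj-sym G u v
coronaAdj-sym G H (inj₁ u)       (inj₂ (v , b)) = ≟-sym u v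
coronaAdj-sym G H (inj₂ (u , a)) (inj₁ v)       = ≟-sym u v
coronaAdj-sym G H (inj₂ (u , a)) (inj₂ (v , b)) = cong₂ _∧_ (≟-sym u v) (adj-sym H a b)

coronaAdj-irr : (G H : Graph) → ∀ x → coronaAdj G H x x ≡ false
coronaAdj-irr G H (inj₁ u)       = adj-irr G u
coronaAdj-irr G H (inj₂ (u , a)) rewrite adj-irr H a = ∧-zeroʳ ⌊ u F.≟ u ⌋

corona : Graph → Graph → Graph
corona G H = record
  { n       = n G + n G * n H
  ; adj     = λ u v → coronaAdj G H (decode G H u) (decode G H v)
  ; adj-sym = λ u v → coronaAdj-sym G H (decode G H u) (decode G H v)
  ; adj-irr = λ v → coronaAdj-irr G H (decode G H v)
  }

LogConcave : (ℕ → ℕ) → ℕ → Set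
LogConcave a d = ∀ k → 1 ≤ k → k + 1 ≤ d → a (k ∸ 1) * a (k + 1) ≤ a k * a k

Unimodal : (ℕ → ℕ) → ℕ → Set
Unimodal a d = Σ ℕ λ m → m ≤ d
  × (∀ k → k < m → a k ≤ a (suc k))
  × (∀ k → m ≤ k → k < d → a (suc k) ≤ a k)

-- The argument works for the corona G ∘ K_1 of an arbitrary graph G with
-- N vertices.  Each vertex v of G carries a pendant leaf whose only
-- neighbour is v.  In an independent dominating set S, independence
-- forbids taking both v and its leaf, and domination of the leaf forces
-- taking one of them; so S contains exactly one vertex of every pair
-- {v, leaf v} and has exactly N elements.  Hence d_i(G ∘ K_1, k) = 0 for
-- k ≠ N: the polynomial is a monomial c·x^N, and a coefficient sequence
-- supported on a single index is trivially log-concave and unimodal.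
module Submission where

open import Defs
open import Data.Nat using (ℕ; _≤_; _+_; _*_)
open import Data.Product using (_×_)

open import Data.Nat using (zero; suc; _∸_; _<_; z≤n; s≤s; z<s)
import Data.Nat as ℕ
open import Data.Nat.Properties
  using (+-suc; *-zeroʳ; m≤m+n; m<m+n; m∸n≤m; ≤-<-trans; <⇒≢; <-irrefl)
open import Data.Bool using (Bool; true; false; _∧_; _∨_; not)
open import Data.Bool.Properties using (∧-conicalˡ; ∧-conicalʳ; ∧-zeroʳ)
open import Data.List using (List; []; _∷_; length; filterᵇ; allFin)
open import Data.List.Membership.Propositional using (_∈_)
open import Data.List.Membership.Propositional.Properties using (∈-allFin)
open import Data.List.Relation.Unary.Any using (here; there)
open import Data.Vec using (Vec; []; _∷_; lookup; _++_)
import Data.Vec as Vec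
open import Data.Vec.Properties using (lookup-++ˡ; lookup-++ʳ)
open import Data.Fin using (Fin; splitAt; combine; join; _↑ˡ_; _↑ʳ_)
import Data.Fin as Fin
open import Data.Fin.Properties using (splitAt-↑ˡ; splitAt-↑ʳ; remQuot-combine; join-splitAt)
open import Data.Sum using (inj₁; inj₂)
open import Data.Product using (_,_; ∃-syntax)
open import Function using (_∘_)
open import Relation.Binary.PropositionalEquality
open import Relation.Nullary using (yes; no; contradiction)
open import Relation.Nullary.Decidable using (⌊_⌋; isYes≗does; dec-true)
open import Data.Empty using (⊥; ⊥-elim)

allB-∈ : {A : Set} (p : A → Bool) (xs : List A) {x : A} →
         allB p xs ≡ true → x ∈ xs → p x ≡ true
allB-∈ p (y ∷ xs) all (here refl) = ∧-conicalˡ (p y) _ all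
allB-∈ p (y ∷ xs) all (there x∈xs) = allB-∈ p xs (∧-conicalʳ (p y) _ all) x∈xs

anyB-witness : {A : Set} (p : A → Bool) (xs : List A) → anyB p xs ≡ true → ∃[ x ] p x ≡ true
anyB-witness p (y ∷ xs) any with p y in py
... | true  = y , py
... | false = anyB-witness p xs any

filterᵇ-none : {A : Set} (p : A → Bool) (xs : List A) →
               (∀ x → p x ≡ false) → length (filterᵇ p xs) ≡ 0
filterᵇ-none p []       never = refl
filterᵇ-none p (x ∷ xs) never rewrite never x = filterᵇ-none p xs never

count-++ : ∀ {a b} (xs : Vec Bool a) (ys : Vec Bool b) → count (xs ++ ys) ≡ count xs + count ys
count-++ []           ys = refl
count-++ (true ∷ xs)  ys = cong suc (count-++ xs ys)
count-++ (false ∷ xs) ys = count-++ xs ys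

count-complementary : ∀ N (xs : Vec Bool N) (ys : Vec Bool (N * 1)) →
  (∀ v → lookup xs v ≡ not (lookup ys (combine v Fin.zero))) → count xs + count ys ≡ N
count-complementary zero    []       []       _    = refl
count-complementary (suc N) (x ∷ xs) (y ∷ ys) comp
  with refl ← comp Fin.zero | ih ← count-complementary N xs ys (comp ∘ Fin.suc) with y
... | true  = trans (+-suc (count xs) (count ys)) (cong suc ih)
... | false = cong suc ih

d-i-vanishes : (G : Graph) (N : ℕ) →
  (∀ S → IsIndependentDominating G S → count S ≡ N) →
  ∀ k → k ≢ N → d-i G k ≡ 0
d-i-vanishes G N size k k≢N = filterᵇ-none _ (allSubsets (n G)) rejected
  where
  rejected : ∀ S → (⌊ count S ℕ.≟ k ⌋ ∧ independentB G S ∧ dominatingB G S) ≡ false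
  rejected S with independentB G S ∧ dominatingB G S in ids
  ... | false = ∧-zeroʳ _
  ... | true with count S ℕ.≟ k
  ...   | yes refl = contradiction (size S ids) k≢N
  ...   | no  _    = refl

module Corona (G : Graph) where

  N : ℕ
  N = n G

  C : Graph
  C = corona G K1

  core leaf : Fin N → Fin (n C)
  core v = v ↑ˡ (N * 1)
  leaf v = N ↑ʳ combine v Fin.zero

  decode-core : ∀ v → decode G K1 (core v) ≡ inj₁ v
  decode-core v rewrite splitAt-↑ˡ N v (N * 1) = refl

  decode-leaf : ∀ v → decode G K1 (leaf v) ≡ inj₂ (v , Fin.zero)
  decode-leaf v rewrite splitAt-↑ʳ N (N * 1) (combine {N} {1} v Fin.zero)
                      | remQuot-combine {N} {1} v Fin.zero = refl

  decode-core⁻¹ : ∀ u w → decode G K1 u ≡ inj₁ w → u ≡ core w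
  decode-core⁻¹ u w decodes with splitAt N u in split
  decode-core⁻¹ u w refl | inj₁ _ =
    trans (sym (join-splitAt N (N * 1) u)) (cong (join N (N * 1)) split)

  core-adj-leaf : ∀ v → adj C (core v) (leaf v) ≡ true
  core-adj-leaf v rewrite decode-core v | decode-leaf v =
    trans (isYes≗does (v Fin.≟ v)) (dec-true (v Fin.≟ v) refl)

  leaf-neighbour : ∀ v u → adj C (leaf v) u ≡ true → u ≡ core v
  leaf-neighbour v u adjacent rewrite decode-leaf v with decode G K1 u in decodes
  ... | inj₂ (w , _) = contradiction (trans (sym (∧-zeroʳ _)) adjacent) λ ()
  ... | inj₁ w with v Fin.≟ w
  ...   | yes refl = decode-core⁻¹ u v decodes

  module _ (S : Vec Bool (n C)) (ids : IsIndependentDominating C S) where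

    independent : independentB C S ≡ true
    independent = ∧-conicalˡ _ _ ids

    dominating : dominatingB C S ≡ true
    dominating = ∧-conicalʳ _ _ ids

    not-both : ∀ v → lookup S (core v) ≡ true → lookup S (leaf v) ≡ true → ⊥
    not-both v inCore inLeaf =
      edge-excluded (allB-∈ _ _ (allB-∈ _ _ independent (∈-allFin (core v))) (∈-allFin (leaf v)))
      where
      edge-excluded : not (lookup S (core v) ∧ lookup S (leaf v) ∧ adj C (core v) (leaf v)) ≡ true → ⊥
      edge-excluded rewrite inCore | inLeaf | core-adj-leaf v = λ ()

    leaf-dominated : ∀ v → lookup S (leaf v) ≡ false →
                     ∃[ u ] (lookup S u ∧ adj C (leaf v) u) ≡ true
    leaf-dominated v outLeaf =
      anyB-witness _ (allFin (n C))
        (subst (λ b → (b ∨ anyB (λ u → lookup S u ∧ adj C (leaf v) u) (allFin (n C))) ≡ true)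
               outLeaf (allB-∈ _ _ dominating (∈-allFin (leaf v))))

    -- Since that member must be core v, one of the pair lies in S.
    one-of : ∀ v → lookup S (leaf v) ≡ false → lookup S (core v) ≡ true
    one-of v outLeaf with u , inS-adj ← leaf-dominated v outLeaf =
      subst (λ x → lookup S x ≡ true)
            (leaf-neighbour v u (∧-conicalʳ _ _ inS-adj)) (∧-conicalˡ _ _ inS-adj)

    core-xor-leaf : ∀ v → lookup S (core v) ≡ not (lookup S (leaf v))
    core-xor-leaf v with lookup S (core v) in inCore | lookup S (leaf v) in inLeaf
    ... | true  | false = refl
    ... | false | true  = refl
    ... | true  | true  = ⊥-elim (not-both v inCore inLeaf)
    ... | false | false = contradiction (trans (sym inCore) (one-of v inLeaf)) λ ()

    ids-size : count S ≡ N
    ids-size with Vec.splitAt N S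
    ... | cores , leaves , refl =
      trans (count-++ cores leaves) (count-complementary N cores leaves complementary)
      where
      complementary : ∀ v → lookup cores v ≡ not (lookup leaves (combine v Fin.zero))
      complementary v = begin
        lookup cores v                           ≡⟨ lookup-++ˡ cores leaves v ⟨
        lookup (cores ++ leaves) (core v)        ≡⟨ core-xor-leaf v ⟩
        not (lookup (cores ++ leaves) (leaf v))  ≡⟨ cong not (lookup-++ʳ cores leaves _) ⟩
        not (lookup leaves (combine v Fin.zero)) ∎
        where open ≡-Reasoning

supported-at : (ℕ → ℕ) → ℕ → Set
supported-at a N = ∀ k → k ≢ N → a k ≡ 0

pred≢suc : ∀ k → k ∸ 1 ≢ k + 1
pred≢suc k = <⇒≢ (≤-<-trans (m∸n≤m k 1) (m<m+n k z<s))

-- At most one of k ∸ 1 and k + 1 lies in the support, so every product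
-- a(k∸1)·a(k+1) vanishes.
single-support-logConcave : ∀ a N d → supported-at a N → LogConcave a d
single-support-logConcave a N d support k _ _ with k ∸ 1 ℕ.≟ N
... | no  k∸1≢N rewrite support (k ∸ 1) k∸1≢N = z≤n
... | yes refl  rewrite support (k + 1) (pred≢suc k ∘ sym)
                      | *-zeroʳ (a (k ∸ 1)) = z≤n

single-support-unimodal : ∀ a N d → N ≤ d → supported-at a N → Unimodal a d
single-support-unimodal a N d N≤d support = N , N≤d , rising , falling
  where
  rising : ∀ k → k < N → a k ≤ a (suc k)
  rising k k<N rewrite support k (λ { refl → <-irrefl refl k<N }) = z≤n
  falling : ∀ k → N ≤ k → k < d → a (suc k) ≤ a k
  falling k N≤k _ rewrite support (suc k) (λ { refl → <-irrefl refl (s≤s N≤k) }) = z≤n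

mainTheorem7 : (t m : ℕ) → 1 ≤ t → 1 ≤ m →
    LogConcave (d-i (corona (Kbip t m) K1)) (n (corona (Kbip t m) K1))
    × Unimodal (d-i (corona (Kbip t m) K1)) (n (corona (Kbip t m) K1))
mainTheorem7 t m _ _ =
    single-support-logConcave (d-i C) N (n C) monomial
  , single-support-unimodal (d-i C) N (n C) (m≤m+n N (N * 1)) monomial
  where
  open Corona (Kbip t m)
  monomial : supported-at (d-i C) N
  monomial = d-i-vanishes C N ids-size
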